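{- Let $\mathcal{A}=(Q,\Sigma,q_I,\Delta,F)$ be a probabilistic automaton with $\Sigma\neq\emptyset$, and let $M_{\mathcal{A}}$, $f_c$ and $g_w$ be as defined below. Then for every word $w\in\Sigma^*$ and every $q\in Q$, $\mathcal{A}_q(w)=[\![g_w]\!]_{M_{\mathcal{A}}}(q)$.
   Context: A probabilistic automaton $\mathcal{A}=(Q,\Sigma,q_I,\Delta,F)$ has finite state set $Q$, finite alphabet $\Sigma$, initial state $q_I$, transition function $\Delta:Q\times\Sigma\to D(Q)$ (probability distributions on $Q$) and accepting set $F\subseteq Q$. For $w=w_1\cdots w_n$, $\mathcal{A}(w)=\sum_{q_0=q_I,\,q_1,\dots,q_{n-1}\in Q,\,q_n\in F}\prod_{i=1}^n\Delta(q_{i-1},w_i)(q_i)$; $\mathcal{A}_q$ is $\mathcal{A}$ with initial state replaced by $q$. The Markov chain $M_{\mathcal{A}}=(S,P,L,s_{in})$ has $S=Q\uplus(Q\times\Sigma)$, $P((q,c),q')=\Delta(q,c)(q')$, $P(q,(q,c))=1/|\Sigma|$, $P=0$ otherwise; atomic propositions $p_c$ ($c\in\Sigma$) and $p_F$ with $L(p_c)=\{(q,c)\mid q\in Q\}$, $L(p_F)=F$; $s_{in}=q_I$. PHFL semantics on a Markov chain: values of type $\mathbf{Prop}$ are functions $S\to[0,1]$; $[\![p]\!](s)=1$ if $s\in L(p)$ and $0$ otherwise; $\land$ is pointwise min; $[\![\Diamond\varphi]\!](s)=\max_{s':P(s,s')>0}[\![\varphi]\!](s')$; $[\![\bigcirc\varphi]\!](s)=\sum_{s'}P(s,s')[\![\varphi]\!](s')$;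 $\lambda$-abstraction and application are interpreted as functions. Define $f_c:=\lambda X.\Diamond(p_c\land\bigcirc X)$ for $c\in\Sigma$, and for $w=w_1\cdots w_n$, $g_w:=f_{w_1}(f_{w_2}(\cdots(f_{w_n}\,p_F)\cdots))$ (so $g_\epsilon=p_F$).
   Formalization: The transition probabilities $\Delta(q,c)(q')$ of the automaton are rational, so the PHFL semantics on $M_{\mathcal{A}}$ is computed over the rationals. -}

module Defs where

open import Data.Nat using (ℕ; zero; suc; NonZero)
open import Data.Fin using (Fin; zero; suc)
open import Data.Bool using (Bool; true; false; if_then_else_)
open import Data.List using (List; []; _∷_; map; _++_; foldr; filter; length; allFin; cartesianProduct)
open import Data.Vec using (Vec; []; _∷_)
open import Data.Product using (_×_; _,_)
open import Data.Sum using (_⊎_; inj₁; inj₂)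
open import Data.Integer using (+_)
open import Data.Rational using (ℚ; _/_; 0ℚ; 1ℚ; _+_; _*_; _⊓_; _⊔_; _≤_; _<_)
open import Data.Rational.Properties using (_<?_)
open import Relation.Binary.PropositionalEquality using (_≡_)
open import Data.Fin using (_≟_)
open import Relation.Nullary using (does)

sumFin : (m : ℕ) → (Fin m → ℚ) → ℚ
sumFin zero    f = 0ℚ
sumFin (suc m) f = f zero + sumFin m (λ i → f (suc i))

-- 1/m, given a witness that m ≠ 0 (an element of Fin m)
oneOver : (m : ℕ) → Fin m → ℚ
oneOver (suc m) _ = + 1 / suc m

record PA (n k : ℕ) : Set where
  field
    qI     : Fin n
    Δ      : Fin n → Fin k → Fin n → ℚ
    Δ-nonneg : ∀ q c q' → 0ℚ ≤ Δ q c q'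
    Δ-sum  : ∀ q c → sumFin n (Δ q c) ≡ 1ℚ
    F      : Fin n → Bool

module _ {n k : ℕ} (A : PA n k) where
  open PA A

  Word : Set
  Word = List (Fin k)

  sumPaths : (l : ℕ) → (Vec (Fin n) l → ℚ) → ℚ
  sumPaths zero    f = f []
  sumPaths (suc l) f = sumFin n (λ q → sumPaths l (λ qs → f (q ∷ qs)))

  pathWeight : (q : Fin n) (w : Word) → Vec (Fin n) (length w) → ℚ
  pathWeight q []      []        = 1ℚ
  pathWeight q (c ∷ w) (q' ∷ qs) = Δ q c q' * pathWeight q' w qs

  lastState : (q : Fin n) (w : Word) → Vec (Fin n) (length w) → Fin n
  lastState q []      []        = q
  lastState q (c ∷ w) (q' ∷ qs) = lastState q' w qs

  indicator : Bool → ℚ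
  indicator true  = 1ℚ
  indicator false = 0ℚ

  accProb : Fin n → Word → ℚ
  accProb q w = sumPaths (length w) (λ qs → indicator (F (lastState q w qs)) * pathWeight q w qs)

  S : Set
  S = Fin n ⊎ (Fin n × Fin k)

  allS : List S
  allS = map inj₁ (allFin n) ++ map inj₂ (cartesianProduct (allFin n) (allFin k))

  P : S → S → ℚ
  P (inj₂ (q , c)) (inj₁ q')  = Δ q c q'
  P (inj₂ _)       (inj₂ _)   = 0ℚ
  P (inj₁ q) (inj₂ (q' , c)) = if does (q ≟ q') then oneOver k c else 0ℚ
  P (inj₁ _)       (inj₁ _)   = 0ℚ

  data AP : Set where
    p[_] : Fin k → AP
    pF   : AP

  L : AP → S → Bool
  L p[ c ] (inj₂ (_ , c')) = does (c ≟ c')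
  L p[ c ] (inj₁ _)        = false
  L pF     (inj₁ q)        = F q
  L pF     (inj₂ _)        = false

  -- PHFL semantics (values of type Prop are functions S → [0,1], here S → ℚ)
  Val : Set
  Val = S → ℚ

  ⟦_⟧ₚ : AP → Val
  ⟦ p ⟧ₚ s = indicator (L p s)

  _∧ₛ_ : Val → Val → Val
  (φ ∧ₛ ψ) s = φ s ⊓ ψ s

  -- max over successors s' with P(s,s') > 0 (values are ≥ 0, so 0 is a neutral start)
  ◇ₛ : Val → Val
  ◇ₛ φ s = foldr _⊔_ 0ℚ (map φ (filter (λ s' → 0ℚ <? P s s') allS))

  ○ₛ : Val → Val
  ○ₛ φ s = foldr _+_ 0ℚ (map (λ s' → P s s' * φ s') allS)

  f : Fin k → Val → Val
  f c X = ◇ₛ (⟦ p[ c ] ⟧ₚ ∧ₛ ○ₛ X)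

  g : Word → Val
  g []      = ⟦ pF ⟧ₚ
  g (c ∷ w) = f c (g w)

{-# OPTIONS --safe #-}
-- Reading a letter c from q in M_𝒜 takes two steps: q moves (with probability
-- 1/|Σ|) to one of the states (q, c'), and (q, c) moves according to Δ(q,c).
-- Among the successors of q, the conjunct p_c is 1 only at (q, c) and 0
-- elsewhere, so ◇ selects (q, c), where ○ computes Σ_q' Δ(q,c)(q') · X(q').
-- With X = g_w this is the one-step unfolding 𝒜_q(cw) = Σ_q' Δ(q,c)(q') 𝒜_q'(w),
-- and induction on w concludes.  The minimum with p_c and the maximum over
-- successors are harmless because acceptance probabilities lie in [0,1].
module Submission where

open import Defs
open import Algebra.Bundles using (CommutativeMonoid)
open import Data.Bool using (true; false)
open import Data.Empty using (⊥-elim)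
open import Data.Fin using (Fin; zero; suc; _≟_)
open import Data.List using (List; []; _∷_; map; _++_; foldr; length; allFin; cartesianProduct; tabulate)
open import Data.List.Properties using (map-++; foldr-++)
open import Data.List.Membership.Propositional using (_∈_)
open import Data.List.Membership.Propositional.Properties using (∈-filter⁺; ∈-map⁺; ∈-++⁺ʳ; ∈-cartesianProduct⁺; ∈-allFin)
open import Data.List.Relation.Unary.All as All using (All; []; _∷_)
open import Data.List.Relation.Unary.All.Properties using (all-filter; map⁺)
open import Data.List.Relation.Unary.Any using (here; there)
open import Data.Nat using (ℕ; NonZero; zero; suc)
open import Data.Product using (_×_; _,_; proj₁; proj₂; ∃-syntax)
open import Data.Rational using (ℚ; 0ℚ; 1ℚ; _+_; _*_; _⊓_; _⊔_; _≤_; _<_; nonNegative)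
open import Data.Rational.Properties
  using ( ≤-refl; ≤-reflexive; ≤-trans; ≤-antisym; <-irrefl; _<?_; +-mono-≤; +-identityʳ
        ; *-zeroˡ; *-zeroʳ; *-identityʳ; *-distribˡ-+; *-monoˡ-≤-nonNeg; *-1-commutativeMonoid
        ; ⊔-lub; p≤p⊔q; p≤q⇒p≤r⊔q; p⊓q≤p; p⊓q≤q; p≥q⇒p⊓q≡q; positive⁻¹; nonNegative⁻¹; normalize-pos)
open import Data.Sum using (inj₁; inj₂)
open import Data.Vec using (Vec; []; _∷_)
open import Relation.Nullary using (Dec; yes; no; does)
open import Relation.Nullary.Decidable using (dec-true)
open import Relation.Binary.PropositionalEquality
  using (_≡_; refl; sym; trans; cong; cong₂; subst; module ≡-Reasoning)
open import Algebra.Properties.CommutativeSemigroup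
  (CommutativeMonoid.commutativeSemigroup *-1-commutativeMonoid) using (x∙yz≈y∙xz)

open ≡-Reasoning

InUnitInterval : ℚ → Set
InUnitInterval x = 0ℚ ≤ x × x ≤ 1ℚ

*-nonNeg : ∀ {a b} → 0ℚ ≤ a → 0ℚ ≤ b → 0ℚ ≤ a * b
*-nonNeg {a} 0≤a 0≤b =
  ≤-trans (≤-reflexive (sym (*-zeroʳ a))) (*-monoˡ-≤-nonNeg a {{nonNegative 0≤a}} 0≤b)

sumFin-cong : ∀ m {h h′ : Fin m → ℚ} → (∀ i → h i ≡ h′ i) → sumFin m h ≡ sumFin m h′
sumFin-cong zero    h≡h′ = refl
sumFin-cong (suc m) h≡h′ = cong₂ _+_ (h≡h′ zero) (sumFin-cong m (λ i → h≡h′ (suc i)))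

*-distribˡ-sumFin : ∀ m b (h : Fin m → ℚ) → b * sumFin m h ≡ sumFin m (λ i → b * h i)
*-distribˡ-sumFin zero    b h = *-zeroʳ b
*-distribˡ-sumFin (suc m) b h =
  trans (*-distribˡ-+ b (h zero) _) (cong (b * h zero +_) (*-distribˡ-sumFin m b (λ i → h (suc i))))

sumFin-nonNeg : ∀ m (h : Fin m → ℚ) → (∀ i → 0ℚ ≤ h i) → 0ℚ ≤ sumFin m h
sumFin-nonNeg zero    h 0≤h = ≤-refl
sumFin-nonNeg (suc m) h 0≤h =
  ≤-trans (≤-reflexive (sym (+-identityʳ 0ℚ)))
          (+-mono-≤ (0≤h zero) (sumFin-nonNeg m _ (λ i → 0≤h (suc i))))

sumFin-mono-≤ : ∀ m (h h′ : Fin m → ℚ) → (∀ i → h i ≤ h′ i) → sumFin m h ≤ sumFin m h′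
sumFin-mono-≤ zero    h h′ h≤h′ = ≤-refl
sumFin-mono-≤ (suc m) h h′ h≤h′ = +-mono-≤ (h≤h′ zero) (sumFin-mono-≤ m _ _ (λ i → h≤h′ (suc i)))

convexCombination-inUnitInterval :
  ∀ m (p x : Fin m → ℚ) → (∀ i → 0ℚ ≤ p i) → sumFin m p ≡ 1ℚ →
  (∀ i → InUnitInterval (x i)) → InUnitInterval (sumFin m (λ i → p i * x i))
convexCombination-inUnitInterval m p x 0≤p Σp≡1 x∈𝕀 = lower , upper
  where
  lower : 0ℚ ≤ sumFin m (λ i → p i * x i)
  lower = sumFin-nonNeg m _ (λ i → *-nonNeg (0≤p i) (proj₁ (x∈𝕀 i)))

  px≤p : ∀ i → p i * x i ≤ p i
  px≤p i = ≤-trans (*-monoˡ-≤-nonNeg (p i) {{nonNegative (0≤p i)}} (proj₂ (x∈𝕀 i)))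
                   (≤-reflexive (*-identityʳ (p i)))

  upper : sumFin m (λ i → p i * x i) ≤ 1ℚ
  upper = ≤-trans (sumFin-mono-≤ m _ p px≤p) (≤-reflexive Σp≡1)

foldr-⊔-≡ : ∀ {v} {ys : List ℚ} → 0ℚ ≤ v → v ∈ ys → All (_≤ v) ys → foldr _⊔_ 0ℚ ys ≡ v
foldr-⊔-≡ {v} 0≤v v∈ys ys≤v = ≤-antisym (lub ys≤v) (ub v∈ys)
  where
  lub : ∀ {ys} → All (_≤ v) ys → foldr _⊔_ 0ℚ ys ≤ v
  lub []           = 0≤v
  lub (y≤v ∷ ys≤v) = ⊔-lub y≤v (lub ys≤v)

  ub : ∀ {y ys} → y ∈ ys → y ≤ foldr _⊔_ 0ℚ ys
  ub {y} {_ ∷ ys} (here refl) = p≤p⊔q y _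
  ub {y} {z ∷ ys} (there y∈ys) = p≤q⇒p≤r⊔q z (ub y∈ys)

oneOver-pos : ∀ {k} (c : Fin k) → 0ℚ < oneOver k c
oneOver-pos {suc k} c = positive⁻¹ _ {{normalize-pos 1 (suc k)}}

module _ {n k : ℕ} (A : PA n k) where
  open PA A

  sumPaths-cong : ∀ l {h h′ : Vec (Fin n) l → ℚ} → (∀ qs → h qs ≡ h′ qs) →
                  sumPaths A l h ≡ sumPaths A l h′
  sumPaths-cong zero    h≡h′ = h≡h′ []
  sumPaths-cong (suc l) h≡h′ = sumFin-cong n (λ q → sumPaths-cong l (λ qs → h≡h′ (q ∷ qs)))

  *-distribˡ-sumPaths : ∀ l b (h : Vec (Fin n) l → ℚ) →
                        b * sumPaths A l h ≡ sumPaths A l (λ qs → b * h qs)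
  *-distribˡ-sumPaths zero    b h = refl
  *-distribˡ-sumPaths (suc l) b h =
    trans (*-distribˡ-sumFin n b _)
          (sumFin-cong n (λ q → *-distribˡ-sumPaths l b (λ qs → h (q ∷ qs))))

  accProb-∷ : ∀ q c w → accProb A q (c ∷ w) ≡ sumFin n (λ q′ → Δ q c q′ * accProb A q′ w)
  accProb-∷ q c w = sumFin-cong n λ q′ →
    trans (sumPaths-cong (length w) λ qs →
             x∙yz≈y∙xz (indicator A (F (lastState A q′ w qs))) (Δ q c q′) (pathWeight A q′ w qs))
          (sym (*-distribˡ-sumPaths (length w) (Δ q c q′) _))

  indicator-inUnitInterval : ∀ b → InUnitInterval (indicator A b)
  indicator-inUnitInterval true  = nonNegative⁻¹ 1ℚ , ≤-refl
  indicator-inUnitInterval false = ≤-refl , nonNegative⁻¹ 1ℚ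

  accProb-inUnitInterval : ∀ w q → InUnitInterval (accProb A q w)
  accProb-inUnitInterval []      q =
    subst InUnitInterval (sym (*-identityʳ _)) (indicator-inUnitInterval (F q))
  accProb-inUnitInterval (c ∷ w) q =
    subst InUnitInterval (sym (accProb-∷ q c w))
      (convexCombination-inUnitInterval n (Δ q c) _ (Δ-nonneg q c) (Δ-sum q c)
        (λ q′ → accProb-inUnitInterval w q′))

  ○ₛ-inj₂ : ∀ X q c → ○ₛ A X (inj₂ (q , c)) ≡ sumFin n (λ q′ → Δ q c q′ * X (inj₁ q′))
  ○ₛ-inj₂ X q c = begin
    foldr _+_ 0ℚ (map h (states ++ letterStates))
      ≡⟨ cong (foldr _+_ 0ℚ) (map-++ h states letterStates) ⟩
    foldr _+_ 0ℚ (map h states ++ map h letterStates)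
      ≡⟨ foldr-++ _+_ 0ℚ (map h states) (map h letterStates) ⟩
    foldr _+_ (foldr _+_ 0ℚ (map h letterStates)) (map h states)
      ≡⟨ cong (λ z → foldr _+_ z (map h states)) (sum-letterStates≡0 (cartesianProduct (allFin n) (allFin k))) ⟩
    foldr _+_ 0ℚ (map h states)
      ≡⟨ sum-states≡sumFin n (λ i → i) ⟩
    sumFin n (λ q′ → Δ q c q′ * X (inj₁ q′)) ∎
    where
    h : S A → ℚ
    h s′ = P A (inj₂ (q , c)) s′ * X s′

    states : List (S A)
    states = map inj₁ (allFin n)

    letterStates : List (S A)
    letterStates = map inj₂ (cartesianProduct (allFin n) (allFin k))

    sum-letterStates≡0 : ∀ qcs → foldr _+_ 0ℚ (map h (map inj₂ qcs)) ≡ 0ℚ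
    sum-letterStates≡0 []          = refl
    sum-letterStates≡0 (qc′ ∷ qcs) =
      cong₂ _+_ (*-zeroˡ (X (inj₂ qc′))) (sum-letterStates≡0 qcs)

    sum-states≡sumFin : ∀ m (e : Fin m → Fin n) →
      foldr _+_ 0ℚ (map h (map inj₁ (tabulate e))) ≡ sumFin m (λ i → h (inj₁ (e i)))
    sum-states≡sumFin zero    e = refl
    sum-states≡sumFin (suc m) e = cong (h (inj₁ (e zero)) +_) (sum-states≡sumFin m (λ i → e (suc i)))

  inj₂-∈-allS : ∀ q c → inj₂ (q , c) ∈ allS A
  inj₂-∈-allS q c =
    ∈-++⁺ʳ (map inj₁ (allFin n)) (∈-map⁺ inj₂ (∈-cartesianProduct⁺ (∈-allFin q) (∈-allFin c)))

  P-inj₁-inj₂-pos : ∀ q c → 0ℚ < P A (inj₁ q) (inj₂ (q , c))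
  P-inj₁-inj₂-pos q c rewrite dec-true (q ≟ q) refl = oneOver-pos c

  P-inj₁-pos⇒inj₂ : ∀ q s → 0ℚ < P A (inj₁ q) s → ∃[ c ] s ≡ inj₂ (q , c)
  P-inj₁-pos⇒inj₂ q (inj₁ q′)       0<0 = ⊥-elim (<-irrefl refl 0<0)
  P-inj₁-pos⇒inj₂ q (inj₂ (q′ , c)) 0<P with q ≟ q′
  ... | yes refl = c , refl
  ... | no  _    = ⊥-elim (<-irrefl refl 0<P)

  ◇ₛ-inj₁ : ∀ φ q c {v} → φ (inj₂ (q , c)) ≡ v → 0ℚ ≤ v →
            (∀ c′ → φ (inj₂ (q , c′)) ≤ v) → ◇ₛ A φ (inj₁ q) ≡ v
  ◇ₛ-inj₁ φ q c refl 0≤v φ≤v = foldr-⊔-≡ 0≤v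
    (∈-map⁺ φ (∈-filter⁺ successor? (inj₂-∈-allS q c) (P-inj₁-inj₂-pos q c)))
    (map⁺ (All.map bound (all-filter successor? (allS A))))
    where
    successor? : (s : S A) → Dec (0ℚ < P A (inj₁ q) s)
    successor? s = 0ℚ <? P A (inj₁ q) s

    bound : ∀ {s} → 0ℚ < P A (inj₁ q) s → φ s ≤ φ (inj₂ (q , c))
    bound {s} 0<P with P-inj₁-pos⇒inj₂ q s 0<P
    ... | c′ , refl = φ≤v c′

  f-inj₁ : ∀ X q c → InUnitInterval (○ₛ A X (inj₂ (q , c))) →
           f A c X (inj₁ q) ≡ ○ₛ A X (inj₂ (q , c))
  f-inj₁ X q c (0≤○X , ○X≤1) = ◇ₛ-inj₁ _ q c chosen 0≤○X bound
    where
    chosen : indicator A (does (c ≟ c)) ⊓ ○ₛ A X (inj₂ (q , c)) ≡ ○ₛ A X (inj₂ (q , c))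
    chosen rewrite dec-true (c ≟ c) refl = p≥q⇒p⊓q≡q ○X≤1

    bound : ∀ c′ → indicator A (does (c ≟ c′)) ⊓ ○ₛ A X (inj₂ (q , c′)) ≤ ○ₛ A X (inj₂ (q , c))
    bound c′ with c ≟ c′
    ... | yes refl = p⊓q≤q 1ℚ _
    ... | no  _    = ≤-trans (p⊓q≤p 0ℚ (○ₛ A X (inj₂ (q , c′)))) 0≤○X

lemma3p4 : {n k : ℕ} → .{{_ : NonZero k}} → (A : PA n k) →
    (w : List (Fin k)) (q : Fin n) → accProb A q w ≡ g A w (inj₁ q)
lemma3p4 A []      q = *-identityʳ _
lemma3p4 {n} A (c ∷ w) q =
  trans accProb≡○g (sym (f-inj₁ A (g A w) q c ○g∈𝕀))
  where
  open PA A

  accProb≡○g : accProb A q (c ∷ w) ≡ ○ₛ A (g A w) (inj₂ (q , c))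
  accProb≡○g = begin
    accProb A q (c ∷ w)                           ≡⟨ accProb-∷ A q c w ⟩
    sumFin n (λ q′ → Δ q c q′ * accProb A q′ w)   ≡⟨ sumFin-cong n (λ q′ → cong (Δ q c q′ *_) (lemma3p4 A w q′)) ⟩
    sumFin n (λ q′ → Δ q c q′ * g A w (inj₁ q′))  ≡⟨ ○ₛ-inj₂ A (g A w) q c ⟨
    ○ₛ A (g A w) (inj₂ (q , c))                   ∎

  ○g∈𝕀 : InUnitInterval (○ₛ A (g A w) (inj₂ (q , c)))
  ○g∈𝕀 = subst InUnitInterval accProb≡○g (accProb-inUnitInterval A (c ∷ w) q)
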